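{- Let $n\ge 2$, let $m\ge 2$ be even, and let $x_1,x_2,\dots,x_m$ be distinct elements of $\{1,\dots,n\}$, so that $(x_1\,x_2),(x_3\,x_4),\dots,(x_{m-1}\,x_m)$ are pairwise disjoint transpositions. Let $H=\langle (x_1\,x_2)(x_3\,x_4)\cdots(x_{m-1}\,x_m)\rangle$ and suppose $H$ is a subgroup of the alternating group $A_n$. Then $H$ is not a perfect code of $S_n$.
   Context: For a group $G$ and a subset $S\subseteq G\setminus\{1_G\}$ with $S=S^{ -1}$, the Cayley graph $\mathrm{Cay}(G,S)$ has vertex set $G$, with $g$ and $h$ adjacent iff $hg^{ -1}\in S$. A perfect code in a graph $\Gamma$ is a subset $C$ of the vertex set such that no two vertices of $C$ are adjacent and every vertex outside $C$ is adjacent to exactly one vertex of $C$. A subgroup $H$ of a group $G$ is a perfect code of $G$ (is "perfect in $G$") if there exists a Cayley graph $\mathrm{Cay}(G,S)$ of $G$ in which $H$ is a perfect code. -}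

module Defs where

open import Data.Nat using (ℕ; zero; suc)
open import Data.Fin using (Fin; zero; suc)
open import Data.Fin.Permutation using (Permutation′; _⟨$⟩ʳ_; _≈_; id; flip; _∘ₚ_; transpose)
open import Data.List using (List; []; _∷_; length)
open import Data.Product using (Σ; ∃; _×_; _,_)
open import Relation.Nullary using (¬_)
open import Relation.Binary.PropositionalEquality using (_≡_)
import Data.Nat as ℕ

-- Elements of the symmetric group S_n: permutations of Fin n,
-- equality is pointwise equality _≈_.
Sym : ℕ → Set
Sym n = Permutation′ n

-- Group product in the usual function-composition convention:
-- (a · b) x = a (b x).
infixl 7 _·_
_·_ : ∀ {n} → Sym n → Sym n → Sym n
a · b = b ∘ₚ a

_⁻¹ : ∀ {n} → Sym n → Sym n
a ⁻¹ = flip a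

_^_ : ∀ {n} → Sym n → ℕ → Sym n
a ^ zero = id
a ^ suc k = a · (a ^ k)

⟨_⟩ : ∀ {n} → Sym n → Sym n → Set
⟨ t ⟩ σ = ∃ λ (k : ℕ) → σ ≈ (t ^ k)

prodTransp : ∀ {n} → List (Fin n × Fin n) → Sym n
prodTransp [] = id
prodTransp ((i , j) ∷ ps) = transpose i j · prodTransp ps

adjPairs : ∀ {n} (m : ℕ) → (Fin m → Fin n) → List (Fin n × Fin n)
adjPairs zero x = []
adjPairs (suc zero) x = []
adjPairs (suc (suc m)) x = (x zero , x (suc zero)) ∷ adjPairs m (λ i → x (suc (suc i)))

IsEven : ∀ {n} → Sym n → Set
IsEven {n} σ = Σ (List (Fin n × Fin n)) λ ps →
  (∀ {i j} → Data.List.Membership.Propositional._∈_ (i , j) ps → ¬ i ≡ j)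
  × (∃ λ k → length ps ≡ k ℕ.* 2) × (σ ≈ prodTransp ps)
  where import Data.List.Membership.Propositional

RespectsEq : ∀ {n} → (Sym n → Set) → Set
RespectsEq {n} P = ∀ {a b : Sym n} → a ≈ b → P a → P b

-- Cay(G,S): g ~ h iff h g⁻¹ ∈ S
Adj : ∀ {n} → (Sym n → Set) → Sym n → Sym n → Set
Adj S g h = S (h · g ⁻¹)

IsPerfectCodeIn : ∀ {n} → (Sym n → Set) → (Sym n → Set) → Set
IsPerfectCodeIn {n} S C =
  (∀ (g h : Sym n) → C g → C h → ¬ Adj S g h)
  × (∀ (g : Sym n) → ¬ C g →
       ∃ λ (h : Sym n) → C h × Adj S h g
         × (∀ (h′ : Sym n) → C h′ → Adj S h′ g → h′ ≈ h))

IsConnectionSet : ∀ {n} → (Sym n → Set) → Set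
IsConnectionSet {n} S =
  RespectsEq S × (∀ (s : Sym n) → S s → ¬ s ≈ id) × (∀ (s : Sym n) → S s → S (s ⁻¹))

IsPerfectCodeOfSym : (n : ℕ) → (Sym n → Set) → Set₁
IsPerfectCodeOfSym n H = ∃ λ (S : Sym n → Set) → IsConnectionSet S × IsPerfectCodeIn S H

{-# OPTIONS --safe #-}
module Submission where

-- Write t = (x₁ x₂)(x₃ x₄)⋯(x_{m-1} x_m), so that H = ⟨t⟩ = {1, t}. Counting inversions gives a
-- sign homomorphism S_n → ℤ/2 under which t has sign m/2; as t is even, 4 ∣ m. Hence t = g² for
-- the product g of the disjoint 4-cycles (x₁ x₃ x₂ x₄)(x₅ x₇ x₆ x₈)⋯, and g ∉ H. In any Cayley
-- graph Cay(S_n, S) with S = S⁻¹, if h is a neighbour of g then so is g h⁻¹ g. For a perfect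
-- code H the H-neighbour h of g is unique, so h = g h⁻¹ g; but h ↦ g h⁻¹ g swaps 1 and t.

open import Defs
open import Data.Bool.Base using (Bool; true; false; not; _∧_; _xor_; if_then_else_)
open import Data.Bool.Properties using (not-distribˡ-xor; not-distribʳ-xor; not-involutive; xor-same; xor-assoc; ∧-zeroʳ)
open import Data.Empty using (⊥-elim)
open import Data.Fin.Base using (Fin; zero; suc; _↑ˡ_; _↑ʳ_)
open import Data.Fin.Patterns using (0F; 1F; 2F; 3F)
open import Data.Fin.Permutation using (_⟨$⟩ʳ_; _⟨$⟩ˡ_; inverseˡ; inverseʳ; transpose; _≈_) renaming (id to idₚ)
import Data.Fin.Permutation.Components as PC
open import Data.Fin.Properties using (_≟_; _<?_; <-irrefl; <-asym; <-cmp; ↑ˡ-injective; ↑ʳ-injective; any?)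
open import Data.List.Base using (List; []; _∷_; length)
open import Data.List.Membership.Propositional using (_∈_)
open import Data.List.Relation.Unary.Any using (here; there)
open import Data.Nat.Base using (ℕ; zero; suc; _+_; _*_; _≤_; s≤s; parity; ⌊_/2⌋)
open import Data.Nat.Divisibility using (_∣_; divides)
open import Data.Nat.Properties using (+-0-commutativeMonoid; +-identityʳ; *-cancelˡ-≡)
open import Algebra.Properties.CommutativeMonoid.Sum +-0-commutativeMonoid
  using (sum-syntax; ∑-distrib-+; ∑-comm; ∑-permute; sum-cong-≗; sum-replicate-zero)
open import Data.Parity.Base as ℙ using (Parity; 0ℙ; 1ℙ)
import Data.Parity.Properties as ℙ
open import Data.Product.Base using (_×_; _,_; ∃-syntax; proj₁; proj₂)
open import Data.Sum.Base using (_⊎_; inj₁; inj₂)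
open import Data.Vec.Functional using (take; drop)
open import Function.Base using (_∘_)
open import Function.Bundles using (Injection)
open import Function.Definitions using (Injective)
open import Function.Properties.Inverse using (↔⇒↣)
open import Relation.Binary.Definitions using (tri<; tri≈; tri>)
open import Relation.Binary.PropositionalEquality using (_≡_; _≢_; refl; sym; trans; subst; cong; cong₂; module ≡-Reasoning)
open import Relation.Nullary using (¬_)
open import Relation.Nullary.Decidable using (Dec; does; yes; no; dec-true; dec-false)

private variable n : ℕ

⟨$⟩ʳ-injective : (π : Sym n) → Injective _≡_ _≡_ (π ⟨$⟩ʳ_)
⟨$⟩ʳ-injective π = Injection.injective (↔⇒↣ π)

transpose-matchˡ : (i j : Fin n) → transpose i j ⟨$⟩ʳ i ≡ j
transpose-matchˡ i j rewrite dec-true (i ≟ i) refl = refl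

transpose-matchʳ : (i j : Fin n) → transpose i j ⟨$⟩ʳ j ≡ i
transpose-matchʳ i j with j ≟ i
... | yes refl = refl
... | no _ rewrite dec-true (j ≟ j) refl = refl

transpose-noMatch : {i j k : Fin n} → k ≢ i → k ≢ j → transpose i j ⟨$⟩ʳ k ≡ k
transpose-noMatch {i = i} {j} {k} k≢i k≢j rewrite dec-false (k ≟ i) k≢i | dec-false (k ≟ j) k≢j = refl

transpose-conjugate : (σ : Sym n) (i j : Fin n) → σ · transpose i j ≈ transpose (σ ⟨$⟩ʳ i) (σ ⟨$⟩ʳ j) · σ
transpose-conjugate σ i j k = by-cases (k ≟ i) (k ≟ j)
  where
  by-cases : Dec (k ≡ i) → Dec (k ≡ j) →
             σ ⟨$⟩ʳ (transpose i j ⟨$⟩ʳ k) ≡ transpose (σ ⟨$⟩ʳ i) (σ ⟨$⟩ʳ j) ⟨$⟩ʳ (σ ⟨$⟩ʳ k)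
  by-cases (yes refl) _ = trans (cong (σ ⟨$⟩ʳ_) (transpose-matchˡ k j)) (sym (transpose-matchˡ (σ ⟨$⟩ʳ k) (σ ⟨$⟩ʳ j)))
  by-cases (no _) (yes refl) = trans (cong (σ ⟨$⟩ʳ_) (transpose-matchʳ i k)) (sym (transpose-matchʳ (σ ⟨$⟩ʳ i) (σ ⟨$⟩ʳ k)))
  by-cases (no k≢i) (no k≢j) = trans (cong (σ ⟨$⟩ʳ_) (transpose-noMatch k≢i k≢j))
    (sym (transpose-noMatch (k≢i ∘ ⟨$⟩ʳ-injective σ) (k≢j ∘ ⟨$⟩ʳ-injective σ)))

transpose-involutive : (i j : Fin n) → transpose i j · transpose i j ≈ idₚ
transpose-involutive i j y = by-cases (y ≟ i) (y ≟ j)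
  where
  τ = transpose i j ⟨$⟩ʳ_
  by-cases : Dec (y ≡ i) → Dec (y ≡ j) → τ (τ y) ≡ y
  by-cases (yes refl) _ = trans (cong τ (transpose-matchˡ y j)) (transpose-matchʳ y j)
  by-cases (no _) (yes refl) = trans (cong τ (transpose-matchʳ i y)) (transpose-matchˡ i y)
  by-cases (no y≢i) (no y≢j) = trans (cong τ (transpose-noMatch y≢i y≢j)) (transpose-noMatch y≢i y≢j)

-- The sign of a permutation

𝟙 : Bool → ℕ
𝟙 b = if b then 1 else 0

module _ {n : ℕ} where

  _<ᵇ_ : Fin n → Fin n → Bool
  i <ᵇ j = does (i <? j)

  <ᵇ-irrefl : ∀ i → i <ᵇ i ≡ false
  <ᵇ-irrefl i = dec-false (i <? i) (<-irrefl refl)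

  <ᵇ-asym : ∀ i j → i <ᵇ j ∧ j <ᵇ i ≡ false
  <ᵇ-asym i j with <-cmp i j
  ... | tri< _ _ j≮i rewrite dec-false (j <? i) j≮i = ∧-zeroʳ (i <ᵇ j)
  ... | tri≈ _ refl _ rewrite <ᵇ-irrefl i = refl
  ... | tri> i≮j _ _ rewrite dec-false (i <? j) i≮j = refl

  <ᵇ-connex : ∀ {i j} → i ≢ j → i <ᵇ j ≡ not (j <ᵇ i)
  <ᵇ-connex {i} {j} i≢j with <-cmp i j
  ... | tri< i<j _ j≮i = trans (dec-true (i <? j) i<j) (cong not (sym (dec-false (j <? i) j≮i)))
  ... | tri≈ _ i≡j _ = ⊥-elim (i≢j i≡j)
  ... | tri> i≮j _ j<i = trans (dec-false (i <? j) i≮j) (cong not (sym (dec-true (j <? i) j<i)))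

  ∑∑-cong : {u v : Fin n → Fin n → ℕ} → (∀ a b → u a b ≡ v a b) →
            ∑[ a < n ] ∑[ b < n ] u a b ≡ ∑[ a < n ] ∑[ b < n ] v a b
  ∑∑-cong u≡v = sum-cong-≗ (λ a → sum-cong-≗ (u≡v a))

  ∑∑-distrib-+ : (u v : Fin n → Fin n → ℕ) →
                 ∑[ a < n ] ∑[ b < n ] (u a b + v a b) ≡ ∑[ a < n ] ∑[ b < n ] u a b + ∑[ a < n ] ∑[ b < n ] v a b
  ∑∑-distrib-+ u v = trans (sum-cong-≗ (λ a → ∑-distrib-+ (u a) (v a))) (∑-distrib-+ (λ a → ∑[ b < n ] u a b) (λ a → ∑[ b < n ] v a b))

  pairs : (Fin n → Fin n → Bool) → ℕ
  pairs r = ∑[ a < n ] ∑[ b < n ] 𝟙 (a <ᵇ b ∧ r a b)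

  pairs-cong : {r s : Fin n → Fin n → Bool} → (∀ a b → a <ᵇ b ≡ true → r a b ≡ s a b) → pairs r ≡ pairs s
  pairs-cong {r} {s} r≡s = ∑∑-cong agree
    where
    agree : ∀ a b → 𝟙 (a <ᵇ b ∧ r a b) ≡ 𝟙 (a <ᵇ b ∧ s a b)
    agree a b with a <ᵇ b in a<b
    ... | true = cong 𝟙 (r≡s a b a<b)
    ... | false = refl

  pairs-empty : {r : Fin n → Fin n → Bool} → (∀ a b → a <ᵇ b ∧ r a b ≡ false) → pairs r ≡ 0
  pairs-empty {r} none = trans (∑∑-cong (λ a b → cong 𝟙 (none a b)))
                            (trans (sum-cong-≗ {n} (λ _ → sum-replicate-zero n)) (sum-replicate-zero n))

  ∑∑-permute : (u : Fin n → Fin n → ℕ) (π : Sym n) →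
               ∑[ a < n ] ∑[ b < n ] u (π ⟨$⟩ʳ a) (π ⟨$⟩ʳ b) ≡ ∑[ a < n ] ∑[ b < n ] u a b
  ∑∑-permute u π = trans (sum-cong-≗ {n} (λ a → sym (∑-permute (u (π ⟨$⟩ʳ a)) π)))
                         (sym (∑-permute (λ a → ∑[ b < n ] u a b) π))

  parity-pairs-xor : (r s : Fin n → Fin n → Bool) →
                     parity (pairs (λ a b → r a b xor s a b)) ≡ parity (pairs r) ℙ.+ parity (pairs s)
  parity-pairs-xor r s = begin
    parity X                                    ≡⟨ ℙ.+-identityʳ (parity X) ⟨
    parity X ℙ.+ 0ℙ                             ≡⟨ cong (parity X ℙ.+_) (ℙ.p+p≡0ℙ (parity Y)) ⟨
    parity X ℙ.+ (parity Y ℙ.+ parity Y)        ≡⟨ cong (parity X ℙ.+_) (ℙ.+-homo-+ Y Y) ⟨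
    parity X ℙ.+ parity (Y + Y)                 ≡⟨ ℙ.+-homo-+ X (Y + Y) ⟨
    parity (X + (Y + Y))                        ≡⟨ cong parity count ⟩
    parity (pairs r + pairs s)                  ≡⟨ ℙ.+-homo-+ (pairs r) (pairs s) ⟩
    parity (pairs r) ℙ.+ parity (pairs s)       ∎
    where
    open ≡-Reasoning
    X = pairs (λ a b → r a b xor s a b)
    Y = pairs (λ a b → r a b ∧ s a b)
    𝟙-xor : ∀ c x y → 𝟙 (c ∧ (x xor y)) + (𝟙 (c ∧ (x ∧ y)) + 𝟙 (c ∧ (x ∧ y))) ≡ 𝟙 (c ∧ x) + 𝟙 (c ∧ y)
    𝟙-xor false x y = refl
    𝟙-xor true false false = refl
    𝟙-xor true false true = refl
    𝟙-xor true true false = refl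
    𝟙-xor true true true = refl
    count : X + (Y + Y) ≡ pairs r + pairs s
    count = begin
      X + (Y + Y)   ≡⟨ cong (X +_) (∑∑-distrib-+ _ _) ⟨
      X + _         ≡⟨ ∑∑-distrib-+ _ _ ⟨
      _             ≡⟨ ∑∑-cong (λ a b → 𝟙-xor (a <ᵇ b) (r a b) (s a b)) ⟩
      _             ≡⟨ ∑∑-distrib-+ _ _ ⟩
      pairs r + pairs s ∎

  pairs-double : (r : Fin n → Fin n → Bool) → (∀ a b → r a b ≡ r b a) → (∀ a → r a a ≡ false) →
                 2 * pairs r ≡ ∑[ a < n ] ∑[ b < n ] 𝟙 (r a b)
  pairs-double r r-sym r-irrefl = begin
    2 * pairs r                  ≡⟨ cong (pairs r +_) (+-identityʳ (pairs r)) ⟩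
    pairs r + pairs r            ≡⟨ cong (pairs r +_) transposed ⟩
    pairs r + _                  ≡⟨ ∑∑-distrib-+ _ _ ⟨
    _                            ≡⟨ ∑∑-cong split ⟩
    ∑[ a < n ] ∑[ b < n ] 𝟙 (r a b) ∎
    where
    open ≡-Reasoning
    transposed : pairs r ≡ ∑[ a < n ] ∑[ b < n ] 𝟙 (b <ᵇ a ∧ r a b)
    transposed = trans (∑-comm (λ a b → 𝟙 (a <ᵇ b ∧ r a b)))
                       (∑∑-cong (λ a b → cong (λ e → 𝟙 (b <ᵇ a ∧ e)) (r-sym b a)))
    split : ∀ a b → 𝟙 (a <ᵇ b ∧ r a b) + 𝟙 (b <ᵇ a ∧ r a b) ≡ 𝟙 (r a b)
    split a b with a ≟ b
    ... | yes refl rewrite r-irrefl a | <ᵇ-irrefl a = refl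
    ... | no a≢b rewrite <ᵇ-connex a≢b with b <ᵇ a
    ...   | true = refl
    ...   | false = +-identityʳ (𝟙 (r a b))

  pairs-permute : (r : Fin n → Fin n → Bool) → (∀ a b → r a b ≡ r b a) → (∀ a → r a a ≡ false) →
                  (π : Sym n) → pairs (λ a b → r (π ⟨$⟩ʳ a) (π ⟨$⟩ʳ b)) ≡ pairs r
  pairs-permute r r-sym r-irrefl π = *-cancelˡ-≡ _ _ 2 (begin
    2 * pairs (λ a b → r (π ⟨$⟩ʳ a) (π ⟨$⟩ʳ b))   ≡⟨ pairs-double _ (λ a b → r-sym _ _) (λ a → r-irrefl _) ⟩
    ∑[ a < n ] ∑[ b < n ] 𝟙 (r (π ⟨$⟩ʳ a) (π ⟨$⟩ʳ b)) ≡⟨ ∑∑-permute (λ a b → 𝟙 (r a b)) π ⟩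
    ∑[ a < n ] ∑[ b < n ] 𝟙 (r a b)               ≡⟨ pairs-double r r-sym r-irrefl ⟨
    2 * pairs r                                   ∎)
    where open ≡-Reasoning

  inversions : (Fin n → Fin n) → ℕ
  inversions f = pairs (λ a b → f b <ᵇ f a)

  sign : Sym n → Parity
  sign σ = parity (inversions (σ ⟨$⟩ʳ_))

  sign-cong : {σ π : Sym n} → σ ≈ π → sign σ ≡ sign π
  sign-cong σ≈π = cong parity (pairs-cong (λ a b _ → cong₂ _<ᵇ_ (σ≈π b) (σ≈π a)))

  sign-id : sign idₚ ≡ 0ℙ
  sign-id = cong parity (pairs-empty (λ a b → <ᵇ-asym a b))

  reverses : (Fin n → Fin n) → Fin n → Fin n → Bool
  reverses f p q = (q <ᵇ p) xor (f q <ᵇ f p)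

  reverses-sym : (σ : Sym n) → ∀ p q → reverses (σ ⟨$⟩ʳ_) p q ≡ reverses (σ ⟨$⟩ʳ_) q p
  reverses-sym σ p q with p ≟ q
  ... | yes refl = refl
  ... | no p≢q = begin
    (q <ᵇ p) xor (s q <ᵇ s p)             ≡⟨ cong₂ _xor_ (<ᵇ-connex (p≢q ∘ sym)) (<ᵇ-connex (p≢q ∘ sym ∘ ⟨$⟩ʳ-injective σ)) ⟩
    not (p <ᵇ q) xor not (s p <ᵇ s q)     ≡⟨ not-distribˡ-xor (p <ᵇ q) _ ⟨
    not ((p <ᵇ q) xor not (s p <ᵇ s q))   ≡⟨ cong not (not-distribʳ-xor (p <ᵇ q) _) ⟨
    not (not ((p <ᵇ q) xor (s p <ᵇ s q))) ≡⟨ not-involutive _ ⟩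
    (p <ᵇ q) xor (s p <ᵇ s q)             ∎
    where
    open ≡-Reasoning
    s = σ ⟨$⟩ʳ_

  reverses-irrefl : (f : Fin n → Fin n) → ∀ p → reverses f p p ≡ false
  reverses-irrefl f p rewrite <ᵇ-irrefl p | <ᵇ-irrefl (f p) = refl

  -- an inversion of σ ∘ π is an inversion of π xor a pair (π a, π b) whose order σ reverses
  sign-· : (σ π : Sym n) → sign (σ · π) ≡ sign σ ℙ.+ sign π
  sign-· σ π = begin
    parity (inversions (s ∘ p))                                  ≡⟨ cong parity (pairs-cong (λ a b _ → split-inversion (p b <ᵇ p a) _)) ⟩
    parity (pairs (λ a b → (p b <ᵇ p a) xor reverses s (p a) (p b))) ≡⟨ parity-pairs-xor (λ a b → p b <ᵇ p a) (λ a b → reverses s (p a) (p b)) ⟩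
    sign π ℙ.+ parity (pairs (λ a b → reverses s (p a) (p b)))   ≡⟨ cong (λ k → sign π ℙ.+ parity k) (pairs-permute _ (reverses-sym σ) (reverses-irrefl s) π) ⟩
    sign π ℙ.+ parity (pairs (reverses s))                       ≡⟨ cong (λ k → sign π ℙ.+ parity k) (pairs-cong reverses-upper) ⟩
    sign π ℙ.+ sign σ                                            ≡⟨ ℙ.+-comm (sign π) (sign σ) ⟩
    sign σ ℙ.+ sign π                                            ∎
    where
    open ≡-Reasoning
    s = σ ⟨$⟩ʳ_
    p = π ⟨$⟩ʳ_
    split-inversion : ∀ x y → y ≡ x xor (x xor y)
    split-inversion x y = trans (cong (_xor y) (sym (xor-same x))) (xor-assoc x x y)
    reverses-upper : ∀ a b → a <ᵇ b ≡ true → reverses s a b ≡ (s b <ᵇ s a)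
    reverses-upper a b a<b = cong (_xor (s b <ᵇ s a)) (subst (λ c → c ∧ (b <ᵇ a) ≡ false) a<b (<ᵇ-asym a b))

  sign-conjugate : (σ : Sym n) (i j : Fin n) → sign (transpose i j) ≡ sign (transpose (σ ⟨$⟩ʳ i) (σ ⟨$⟩ʳ j))
  sign-conjugate σ i j = ℙ.+-cancelˡ-≡ (sign σ) _ _ (begin
    sign σ ℙ.+ sign (transpose i j)   ≡⟨ sign-· σ (transpose i j) ⟨
    sign (σ · transpose i j)          ≡⟨ sign-cong {σ · transpose i j} {τ · σ} (transpose-conjugate σ i j) ⟩
    sign (τ · σ)                      ≡⟨ sign-· τ σ ⟩
    sign τ ℙ.+ sign σ                 ≡⟨ ℙ.+-comm (sign τ) (sign σ) ⟩
    sign σ ℙ.+ sign τ                 ∎)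
    where
    open ≡-Reasoning
    τ = transpose (σ ⟨$⟩ʳ i) (σ ⟨$⟩ʳ j)

-- row 0 holds the only inversion (0, 1), row 1 none, and rows 2, 3, … compute to the inversions of idₚ on Fin k
inversions-transpose₀₁ : ∀ k → inversions (transpose {suc (suc k)} zero (suc zero) ⟨$⟩ʳ_) ≡ 1
inversions-transpose₀₁ k = cong₂ _+_ (cong suc (sum-replicate-zero k))
  (cong₂ _+_ (sum-replicate-zero k) (pairs-empty {k} {r = λ a b → b <ᵇ a} (λ a b → <ᵇ-asym a b)))

sign-transpose : {i j : Fin n} → i ≢ j → sign (transpose i j) ≡ 1ℙ
sign-transpose {suc zero} {zero} {zero} i≢j = ⊥-elim (i≢j refl)
sign-transpose {suc (suc k)} {i} {j} i≢j = begin
  sign (transpose i j)                             ≡⟨ cong₂ (λ p q → sign (transpose p q)) σ₀≡i σ₁≡j ⟨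
  sign (transpose (σ ⟨$⟩ʳ zero) (σ ⟨$⟩ʳ suc zero)) ≡⟨ sign-conjugate σ zero (suc zero) ⟨
  sign (transpose {suc (suc k)} zero (suc zero))   ≡⟨ cong parity (inversions-transpose₀₁ k) ⟩
  1ℙ                                               ∎
  where
  open ≡-Reasoning
  j′ = transpose zero i ⟨$⟩ʳ j
  σ = transpose i zero · transpose (suc zero) j′
  j′≢0 : j′ ≢ zero
  j′≢0 j′≡0 = i≢j (begin
    i                               ≡⟨ transpose-matchʳ i zero ⟨
    transpose i zero ⟨$⟩ʳ zero      ≡⟨ cong (transpose i zero ⟨$⟩ʳ_) j′≡0 ⟨
    transpose i zero ⟨$⟩ʳ j′        ≡⟨ PC.transpose-inverse i zero ⟩
    j                               ∎)
  σ₀≡i : σ ⟨$⟩ʳ zero ≡ i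
  σ₀≡i = trans (cong (transpose i zero ⟨$⟩ʳ_) (transpose-noMatch {i = suc zero} {j = j′} (λ ()) (j′≢0 ∘ sym))) (transpose-matchʳ i zero)
  σ₁≡j : σ ⟨$⟩ʳ suc zero ≡ j
  σ₁≡j = trans (cong (transpose i zero ⟨$⟩ʳ_) (transpose-matchˡ (suc zero) j′)) (PC.transpose-inverse i zero)

sign-prodTransp : (ps : List (Fin n × Fin n)) → (∀ {i j} → (i , j) ∈ ps → i ≢ j) →
                  sign (prodTransp ps) ≡ parity (length ps)
sign-prodTransp {n} [] _ = sign-id {n}
sign-prodTransp ((i , j) ∷ ps) proper = begin
  sign (transpose i j · prodTransp ps)          ≡⟨ sign-· (transpose i j) (prodTransp ps) ⟩
  sign (transpose i j) ℙ.+ sign (prodTransp ps) ≡⟨ cong₂ ℙ._+_ (sign-transpose (proper (here refl))) (sign-prodTransp ps (proper ∘ there)) ⟩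
  1ℙ ℙ.+ parity (length ps)                     ≡⟨ ℙ.+-homo-+ 1 (length ps) ⟨
  parity (suc (length ps))                      ∎
  where open ≡-Reasoning

-- Permutations with disjoint supports

record FixesSupportOf {n} (P Q : Sym n) : Set where
  constructor fixesSupport
  field fixes-moved : ∀ y → Q ⟨$⟩ʳ y ≢ y → P ⟨$⟩ʳ y ≡ y

fixesSupportOf-transpose : {P : Sym n} {i j : Fin n} → P ⟨$⟩ʳ i ≡ i → P ⟨$⟩ʳ j ≡ j → FixesSupportOf P (transpose i j)
fixesSupportOf-transpose {P = P} {i} {j} Pi≡i Pj≡j = fixesSupport (λ y moved → by-cases y moved (y ≟ i) (y ≟ j))
  where
  by-cases : ∀ y → transpose i j ⟨$⟩ʳ y ≢ y → Dec (y ≡ i) → Dec (y ≡ j) → P ⟨$⟩ʳ y ≡ y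
  by-cases y _ (yes refl) _ = Pi≡i
  by-cases y _ (no _) (yes refl) = Pj≡j
  by-cases y moved (no y≢i) (no y≢j) = ⊥-elim (moved (transpose-noMatch y≢i y≢j))

fixesSupportOf-· : {P Q R : Sym n} → FixesSupportOf P Q → FixesSupportOf P R → FixesSupportOf P (Q · R)
fixesSupportOf-· {P = P} {Q} {R} (fixesSupport P-Q) (fixesSupport P-R) = fixesSupport fixes-moved
  where
  fixes-moved : ∀ y → Q ⟨$⟩ʳ (R ⟨$⟩ʳ y) ≢ y → P ⟨$⟩ʳ y ≡ y
  fixes-moved y moved with R ⟨$⟩ʳ y ≟ y
  ... | yes Ry≡y = P-Q y (λ Qy≡y → moved (trans (cong (Q ⟨$⟩ʳ_) Ry≡y) Qy≡y))
  ... | no Ry≢y = P-R y Ry≢y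

fixesSupportOf⇒commute : {P Q : Sym n} → FixesSupportOf P Q → P · Q ≈ Q · P
fixesSupportOf⇒commute {P = P} {Q} (fixesSupport P-Q) y with Q ⟨$⟩ʳ y ≟ y
... | no Qy≢y = trans (P-Q (Q ⟨$⟩ʳ y) (Qy≢y ∘ ⟨$⟩ʳ-injective Q)) (cong (Q ⟨$⟩ʳ_) (sym (P-Q y Qy≢y)))
... | yes Qy≡y with Q ⟨$⟩ʳ (P ⟨$⟩ʳ y) ≟ P ⟨$⟩ʳ y
...   | yes QPy≡Py = trans (cong (P ⟨$⟩ʳ_) Qy≡y) (sym QPy≡Py)
...   | no QPy≢Py = trans (cong (P ⟨$⟩ʳ_) Qy≡y) (trans Py≡y (sym (trans (cong (Q ⟨$⟩ʳ_) Py≡y) Qy≡y)))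
  where
  Py≡y : P ⟨$⟩ʳ y ≡ y
  Py≡y = ⟨$⟩ʳ-injective P (P-Q (P ⟨$⟩ʳ y) QPy≢Py)

square-· : {P Q : Sym n} → P · Q ≈ Q · P → (Q · P) · (Q · P) ≈ (Q · Q) · (P · P)
square-· {Q = Q} PQ≈QP y = cong (Q ⟨$⟩ʳ_) (PQ≈QP _)

drop-injective : ∀ {m} k (x : Fin (k + m) → Fin n) → Injective _≡_ _≡_ x → Injective _≡_ _≡_ (drop k x)
drop-injective k x x-inj = ↑ʳ-injective k _ _ ∘ x-inj

take-injective : ∀ k {m} (x : Fin (k + m) → Fin n) → Injective _≡_ _≡_ x → Injective _≡_ _≡_ (take k x)
take-injective k {m} x x-inj = ↑ˡ-injective m _ _ ∘ x-inj

≈-on-image : ∀ {m} (x : Fin m → Fin n) {P Q : Sym n} → (∀ k → P ⟨$⟩ʳ x k ≡ Q ⟨$⟩ʳ x k) →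
             (∀ {y} → (∀ k → x k ≢ y) → P ⟨$⟩ʳ y ≡ y) → (∀ {y} → (∀ k → x k ≢ y) → Q ⟨$⟩ʳ y ≡ y) → P ≈ Q
≈-on-image x agree P-fixes Q-fixes y with any? (λ k → x k ≟ y)
... | yes (k , refl) = agree k
... | no y∉x = trans (P-fixes y∉x′) (sym (Q-fixes y∉x′))
  where
  y∉x′ : ∀ k → x k ≢ y
  y∉x′ k xk≡y = y∉x (k , xk≡y)

-- The involution (x₁ x₂)(x₃ x₄)⋯ and its square root

prodTransp-adjPairs-fixes : ∀ m (x : Fin m → Fin n) {y} → (∀ k → x k ≢ y) → prodTransp (adjPairs m x) ⟨$⟩ʳ y ≡ y
prodTransp-adjPairs-fixes zero x y∉x = refl
prodTransp-adjPairs-fixes (suc zero) x y∉x = refl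
prodTransp-adjPairs-fixes (suc (suc m)) x y∉x =
  trans (cong (transpose (x 0F) (x 1F) ⟨$⟩ʳ_) (prodTransp-adjPairs-fixes m (drop 2 x) (y∉x ∘ (2 ↑ʳ_))))
        (transpose-noMatch (y∉x 0F ∘ sym) (y∉x 1F ∘ sym))

prodTransp-adjPairs-involutive : ∀ m (x : Fin m → Fin n) → Injective _≡_ _≡_ x →
                                 prodTransp (adjPairs m x) · prodTransp (adjPairs m x) ≈ idₚ
prodTransp-adjPairs-involutive zero x x-inj y = refl
prodTransp-adjPairs-involutive (suc zero) x x-inj y = refl
prodTransp-adjPairs-involutive (suc (suc m)) x x-inj y = begin
  τ ⟨$⟩ʳ (t ⟨$⟩ʳ (τ ⟨$⟩ʳ (t ⟨$⟩ʳ y))) ≡⟨ square-· {P = t} {Q = τ} (fixesSupportOf⇒commute t-fixes-τ) y ⟩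
  τ ⟨$⟩ʳ (τ ⟨$⟩ʳ (t ⟨$⟩ʳ (t ⟨$⟩ʳ y))) ≡⟨ transpose-involutive (x 0F) (x 1F) _ ⟩
  t ⟨$⟩ʳ (t ⟨$⟩ʳ y)                   ≡⟨ prodTransp-adjPairs-involutive m (drop 2 x) (drop-injective 2 x x-inj) y ⟩
  y                                   ∎
  where
  open ≡-Reasoning
  τ = transpose (x 0F) (x 1F)
  t = prodTransp (adjPairs m (drop 2 x))
  t-fixes-τ : FixesSupportOf t τ
  t-fixes-τ = fixesSupportOf-transpose (prodTransp-adjPairs-fixes m (drop 2 x) (λ k → (λ ()) ∘ x-inj))
                                       (prodTransp-adjPairs-fixes m (drop 2 x) (λ k → (λ ()) ∘ x-inj))

prodTransp-adjPairs-nontrivial : ∀ m (x : Fin m → Fin n) → Injective _≡_ _≡_ x → 2 ≤ m →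
                                 ¬ prodTransp (adjPairs m x) ≈ idₚ
prodTransp-adjPairs-nontrivial (suc zero) x x-inj (s≤s ())
prodTransp-adjPairs-nontrivial (suc (suc m)) x x-inj _ t≈id = 0≢1 (x-inj (begin
  x 0F                                                         ≡⟨ t≈id (x 0F) ⟨
  transpose (x 0F) (x 1F) ⟨$⟩ʳ (prodTransp (adjPairs m (drop 2 x)) ⟨$⟩ʳ x 0F)
      ≡⟨ cong (transpose (x 0F) (x 1F) ⟨$⟩ʳ_) (prodTransp-adjPairs-fixes m (drop 2 x) (λ k → (λ ()) ∘ x-inj)) ⟩
  transpose (x 0F) (x 1F) ⟨$⟩ʳ x 0F                            ≡⟨ transpose-matchˡ (x 0F) (x 1F) ⟩
  x 1F                                                         ∎))
  where
  open ≡-Reasoning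
  0≢1 : 0F ≢ 1F
  0≢1 ()

length-adjPairs : ∀ m (x : Fin m → Fin n) → length (adjPairs m x) ≡ ⌊ m /2⌋
length-adjPairs zero x = refl
length-adjPairs (suc zero) x = refl
length-adjPairs (suc (suc m)) x = cong suc (length-adjPairs m (drop 2 x))

adjPairs-proper : ∀ m (x : Fin m → Fin n) → Injective _≡_ _≡_ x → ∀ {i j} → (i , j) ∈ adjPairs m x → i ≢ j
adjPairs-proper (suc (suc m)) x x-inj (here refl) = (λ ()) ∘ x-inj
adjPairs-proper (suc (suc m)) x x-inj (there ij∈) = adjPairs-proper m (drop 2 x) (drop-injective 2 x x-inj) ij∈

sign-prodTransp-adjPairs : ∀ m (x : Fin m → Fin n) → Injective _≡_ _≡_ x →
                           sign (prodTransp (adjPairs m x)) ≡ parity ⌊ m /2⌋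
sign-prodTransp-adjPairs m x x-inj =
  trans (sign-prodTransp (adjPairs m x) (adjPairs-proper m x x-inj)) (cong parity (length-adjPairs m x))

-- the 4-cycle (x₀ x₂ x₁ x₃), a square root of (x₀ x₁)(x₂ x₃)
fourCycle : (Fin 4 → Fin n) → Sym n
fourCycle x = transpose (x 0F) (x 2F) · (transpose (x 2F) (x 1F) · transpose (x 1F) (x 3F))

fourCycle-fixes : (x : Fin 4 → Fin n) {y : Fin n} → (∀ k → x k ≢ y) → fourCycle x ⟨$⟩ʳ y ≡ y
fourCycle-fixes x y∉x =
  trans (cong (λ z → transpose (x 0F) (x 2F) ⟨$⟩ʳ (transpose (x 2F) (x 1F) ⟨$⟩ʳ z)) (transpose-noMatch (y∉x 1F ∘ sym) (y∉x 3F ∘ sym)))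
  (trans (cong (transpose (x 0F) (x 2F) ⟨$⟩ʳ_) (transpose-noMatch (y∉x 2F ∘ sym) (y∉x 1F ∘ sym)))
         (transpose-noMatch (y∉x 0F ∘ sym) (y∉x 2F ∘ sym)))

fixesSupportOf-fourCycle : {P : Sym n} (x : Fin 4 → Fin n) → (∀ k → P ⟨$⟩ʳ x k ≡ x k) → FixesSupportOf P (fourCycle x)
fixesSupportOf-fourCycle x P-fixes =
  fixesSupportOf-· (fixesSupportOf-transpose (P-fixes 0F) (P-fixes 2F))
    (fixesSupportOf-· (fixesSupportOf-transpose (P-fixes 2F) (P-fixes 1F)) (fixesSupportOf-transpose (P-fixes 1F) (P-fixes 3F)))

fourCycle-square : (x : Fin 4 → Fin n) → Injective _≡_ _≡_ x →
                   fourCycle x · fourCycle x ≈ transpose (x 0F) (x 1F) · transpose (x 2F) (x 3F)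
fourCycle-square {n} x x-inj = ≈-on-image x {c · c} {τ₀₁ · τ₂₃} on-x
  (λ y∉x → trans (cong (c ⟨$⟩ʳ_) (fourCycle-fixes x y∉x)) (fourCycle-fixes x y∉x))
  (λ y∉x → trans (cong (τ₀₁ ⟨$⟩ʳ_) (transpose-noMatch (y∉x 2F ∘ sym) (y∉x 3F ∘ sym))) (transpose-noMatch (y∉x 0F ∘ sym) (y∉x 1F ∘ sym)))
  where
  c = fourCycle x
  τ₀₁ = transpose (x 0F) (x 1F)
  τ₂₃ = transpose (x 2F) (x 3F)
  τ : Fin 4 → Fin 4 → Sym n
  τ i j = transpose (x i) (x j)
  skip : ∀ i j k → k ≢ i → k ≢ j → τ i j ⟨$⟩ʳ x k ≡ x k
  skip i j k k≢i k≢j = transpose-noMatch (k≢i ∘ x-inj) (k≢j ∘ x-inj)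
  via-cycle : ∀ {y₁ y₂ y₃} y₀ → τ 1F 3F ⟨$⟩ʳ y₀ ≡ y₁ → τ 2F 1F ⟨$⟩ʳ y₁ ≡ y₂ → τ 0F 2F ⟨$⟩ʳ y₂ ≡ y₃ → c ⟨$⟩ʳ y₀ ≡ y₃
  via-cycle y₀ e₁ e₂ e₃ = trans (cong (λ z → τ 0F 2F ⟨$⟩ʳ (τ 2F 1F ⟨$⟩ʳ z)) e₁) (trans (cong (τ 0F 2F ⟨$⟩ʳ_) e₂) e₃)
  via-pair : ∀ {y₁ y₂} y₀ → τ₂₃ ⟨$⟩ʳ y₀ ≡ y₁ → τ₀₁ ⟨$⟩ʳ y₁ ≡ y₂ → (τ₀₁ · τ₂₃) ⟨$⟩ʳ y₀ ≡ y₂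
  via-pair y₀ e₁ e₂ = trans (cong (τ₀₁ ⟨$⟩ʳ_) e₁) e₂
  c-x₀ : c ⟨$⟩ʳ x 0F ≡ x 2F
  c-x₀ = via-cycle (x 0F) (skip 1F 3F 0F (λ ()) (λ ())) (skip 2F 1F 0F (λ ()) (λ ())) (transpose-matchˡ (x 0F) (x 2F))
  c-x₂ : c ⟨$⟩ʳ x 2F ≡ x 1F
  c-x₂ = via-cycle (x 2F) (skip 1F 3F 2F (λ ()) (λ ())) (transpose-matchˡ (x 2F) (x 1F)) (skip 0F 2F 1F (λ ()) (λ ()))
  c-x₁ : c ⟨$⟩ʳ x 1F ≡ x 3F
  c-x₁ = via-cycle (x 1F) (transpose-matchˡ (x 1F) (x 3F)) (skip 2F 1F 3F (λ ()) (λ ())) (skip 0F 2F 3F (λ ()) (λ ()))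
  c-x₃ : c ⟨$⟩ʳ x 3F ≡ x 0F
  c-x₃ = via-cycle (x 3F) (transpose-matchʳ (x 1F) (x 3F)) (transpose-matchʳ (x 2F) (x 1F)) (transpose-matchʳ (x 0F) (x 2F))
  on-x : ∀ k → (c · c) ⟨$⟩ʳ x k ≡ (τ₀₁ · τ₂₃) ⟨$⟩ʳ x k
  on-x 0F = trans (cong (c ⟨$⟩ʳ_) c-x₀) (trans c-x₂ (sym (via-pair (x 0F) (skip 2F 3F 0F (λ ()) (λ ())) (transpose-matchˡ (x 0F) (x 1F)))))
  on-x 1F = trans (cong (c ⟨$⟩ʳ_) c-x₁) (trans c-x₃ (sym (via-pair (x 1F) (skip 2F 3F 1F (λ ()) (λ ())) (transpose-matchʳ (x 0F) (x 1F)))))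
  on-x 2F = trans (cong (c ⟨$⟩ʳ_) c-x₂) (trans c-x₁ (sym (via-pair (x 2F) (transpose-matchˡ (x 2F) (x 3F)) (skip 0F 1F 3F (λ ()) (λ ())))))
  on-x 3F = trans (cong (c ⟨$⟩ʳ_) c-x₃) (trans c-x₀ (sym (via-pair (x 3F) (transpose-matchʳ (x 2F) (x 3F)) (skip 0F 1F 2F (λ ()) (λ ())))))

-- a last block of fewer than four points is ignored
squareRoot : ∀ m → (Fin m → Fin n) → Sym n
squareRoot (suc (suc (suc (suc m)))) x = fourCycle (take 4 x) · squareRoot m (drop 4 x)
squareRoot _ _ = idₚ

squareRoot-fixes : ∀ m (x : Fin m → Fin n) {y} → (∀ k → x k ≢ y) → squareRoot m x ⟨$⟩ʳ y ≡ y
squareRoot-fixes zero x y∉x = refl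
squareRoot-fixes (suc zero) x y∉x = refl
squareRoot-fixes (suc (suc zero)) x y∉x = refl
squareRoot-fixes (suc (suc (suc zero))) x y∉x = refl
squareRoot-fixes (suc (suc (suc (suc m)))) x y∉x =
  trans (cong (fourCycle (take 4 x) ⟨$⟩ʳ_) (squareRoot-fixes m (drop 4 x) (y∉x ∘ (4 ↑ʳ_))))
        (fourCycle-fixes (take 4 x) (y∉x ∘ (_↑ˡ m)))

squareRoot-square : ∀ {m} → 4 ∣ m → (x : Fin m → Fin n) → Injective _≡_ _≡_ x →
                    squareRoot m x · squareRoot m x ≈ prodTransp (adjPairs m x)
squareRoot-square (divides zero refl) x x-inj y = refl
squareRoot-square (divides (suc q) refl) x x-inj y = begin
  c ⟨$⟩ʳ (r ⟨$⟩ʳ (c ⟨$⟩ʳ (r ⟨$⟩ʳ y)))  ≡⟨ square-· {P = r} {Q = c} (fixesSupportOf⇒commute r-fixes-c) y ⟩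
  c ⟨$⟩ʳ (c ⟨$⟩ʳ (r ⟨$⟩ʳ (r ⟨$⟩ʳ y)))  ≡⟨ fourCycle-square (take 4 x) (take-injective 4 x x-inj) (r ⟨$⟩ʳ (r ⟨$⟩ʳ y)) ⟩
  τ₀₁ ⟨$⟩ʳ (τ₂₃ ⟨$⟩ʳ (r ⟨$⟩ʳ (r ⟨$⟩ʳ y))) ≡⟨ cong (λ z → τ₀₁ ⟨$⟩ʳ (τ₂₃ ⟨$⟩ʳ z)) (squareRoot-square (divides q refl) (drop 4 x) (drop-injective 4 x x-inj) y) ⟩
  prodTransp (adjPairs (4 + m) x) ⟨$⟩ʳ y  ∎
  where
  open ≡-Reasoning
  m = q * 4
  c = fourCycle (take 4 x)
  r = squareRoot m (drop 4 x)
  τ₀₁ = transpose (x 0F) (x 1F)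
  τ₂₃ = transpose (x 2F) (x 3F)
  r-fixes-c : FixesSupportOf r c
  r-fixes-c = fixesSupportOf-fourCycle (take 4 x) (λ k → squareRoot-fixes m (drop 4 x) (λ j → tail≢head j k ∘ x-inj))
    where
    tail≢head : ∀ j k → 4 ↑ʳ j ≢ k ↑ˡ m
    tail≢head j 0F ()
    tail≢head j 1F ()
    tail≢head j 2F ()
    tail≢head j 3F ()

-- Perfect codes

⁻¹-cong : (σ π : Sym n) → σ ≈ π → σ ⁻¹ ≈ π ⁻¹
⁻¹-cong σ π σ≈π y = begin
  σ ⟨$⟩ˡ y                        ≡⟨ cong (σ ⟨$⟩ˡ_) (inverseʳ π) ⟨
  σ ⟨$⟩ˡ (π ⟨$⟩ʳ (π ⟨$⟩ˡ y))      ≡⟨ cong (σ ⟨$⟩ˡ_) (σ≈π _) ⟨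
  σ ⟨$⟩ˡ (σ ⟨$⟩ʳ (π ⟨$⟩ˡ y))      ≡⟨ inverseˡ σ ⟩
  π ⟨$⟩ˡ y                        ∎
  where open ≡-Reasoning

module _ {S : Sym n → Set} (S-conn : IsConnectionSet S) where

  -- (g · h ⁻¹) ⁻¹ = g · (g · h ⁻¹ · g) ⁻¹, and S is closed under inverses
  Adj-reflect : (g h : Sym n) → Adj S h g → Adj S (g · h ⁻¹ · g) g
  Adj-reflect g h h~g = S-resp (λ y → sym (inverseʳ g)) (S-inv (g · h ⁻¹) h~g)
    where
    S-resp = proj₁ S-conn
    S-inv = proj₂ (proj₂ S-conn)

  perfectCode-reflected-neighbour : {C : Sym n → Set} → IsPerfectCodeIn S C → (g : Sym n) → ¬ C g →
                                    (∀ h → C h → C (g · h ⁻¹ · g)) → ∃[ h ] C h × g · h ⁻¹ · g ≈ h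
  perfectCode-reflected-neighbour (_ , covers) g g∉C C-reflect with covers g g∉C
  ... | h , h∈C , h~g , unique = h , h∈C , unique (g · h ⁻¹ · g) (C-reflect h h∈C) (Adj-reflect g h h~g)

module _ {g t : Sym n} (g²≈t : g · g ≈ t) (t²≈id : t · t ≈ idₚ) where

  elements-⟨involution⟩ : ∀ σ → ⟨ t ⟩ σ → σ ≈ idₚ ⊎ σ ≈ t
  elements-⟨involution⟩ σ (k , σ≈tᵏ) with power k
    where
    power : ∀ k → t ^ k ≈ idₚ ⊎ t ^ k ≈ t
    power zero = inj₁ (λ _ → refl)
    power (suc k) with power k
    ... | inj₁ tᵏ≈id = inj₂ (λ y → cong (t ⟨$⟩ʳ_) (tᵏ≈id y))
    ... | inj₂ tᵏ≈t = inj₁ (λ y → trans (cong (t ⟨$⟩ʳ_) (tᵏ≈t y)) (t²≈id y))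
  ... | inj₁ tᵏ≈id = inj₁ (λ y → trans (σ≈tᵏ y) (tᵏ≈id y))
  ... | inj₂ tᵏ≈t = inj₂ (λ y → trans (σ≈tᵏ y) (tᵏ≈t y))

  reflect-id : ∀ h → h ≈ idₚ → g · h ⁻¹ · g ≈ t
  reflect-id h h≈id y = trans (cong (g ⟨$⟩ʳ_) (⁻¹-cong h idₚ h≈id (g ⟨$⟩ʳ y))) (g²≈t y)

  reflect-t : ∀ h → h ≈ t → g · h ⁻¹ · g ≈ idₚ
  reflect-t h h≈t y = begin
    g ⟨$⟩ʳ (h ⟨$⟩ˡ (g ⟨$⟩ʳ y))                     ≡⟨ cong (g ⟨$⟩ʳ_) (⁻¹-cong h t h≈t (g ⟨$⟩ʳ y)) ⟩
    g ⟨$⟩ʳ (t ⟨$⟩ˡ (g ⟨$⟩ʳ y))                     ≡⟨ cong (λ z → g ⟨$⟩ʳ (t ⟨$⟩ˡ z)) t-g⁻¹ ⟨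
    g ⟨$⟩ʳ (t ⟨$⟩ˡ (t ⟨$⟩ʳ (g ⟨$⟩ˡ y)))           ≡⟨ cong (g ⟨$⟩ʳ_) (inverseˡ t) ⟩
    g ⟨$⟩ʳ (g ⟨$⟩ˡ y)                             ≡⟨ inverseʳ g ⟩
    y                                             ∎
    where
    open ≡-Reasoning
    t-g⁻¹ : t ⟨$⟩ʳ (g ⟨$⟩ˡ y) ≡ g ⟨$⟩ʳ y
    t-g⁻¹ = trans (sym (g²≈t (g ⟨$⟩ˡ y))) (cong (g ⟨$⟩ʳ_) (inverseʳ g))

  ¬perfectCode-⟨square⟩ : ¬ t ≈ idₚ → ¬ IsPerfectCodeOfSym n ⟨ t ⟩
  ¬perfectCode-⟨square⟩ t≉id (S , S-conn , code)
    with perfectCode-reflected-neighbour S-conn code g g∉⟨t⟩ reflect-closed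
    where
    g∉⟨t⟩ : ¬ ⟨ t ⟩ g
    g∉⟨t⟩ g∈⟨t⟩ with elements-⟨involution⟩ g g∈⟨t⟩
    ... | inj₁ g≈id = t≉id (λ y → trans (sym (g²≈t y)) (trans (g≈id _) (g≈id y)))
    ... | inj₂ g≈t = t≉id (λ y → trans (sym (g²≈t y)) (trans (g≈t _) (trans (cong (t ⟨$⟩ʳ_) (g≈t y)) (t²≈id y))))
    reflect-closed : ∀ h → ⟨ t ⟩ h → ⟨ t ⟩ (g · h ⁻¹ · g)
    reflect-closed h h∈⟨t⟩ with elements-⟨involution⟩ h h∈⟨t⟩
    ... | inj₁ h≈id = 1 , reflect-id h h≈id
    ... | inj₂ h≈t = 0 , reflect-t h h≈t
  ... | h , h∈⟨t⟩ , ghg≈h with elements-⟨involution⟩ h h∈⟨t⟩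
  ...   | inj₁ h≈id = t≉id (λ y → trans (sym (reflect-id h h≈id y)) (trans (ghg≈h y) (h≈id y)))
  ...   | inj₂ h≈t = t≉id (λ y → trans (sym (h≈t y)) (trans (sym (ghg≈h y)) (reflect-t h h≈t y)))

parity-*2 : ∀ k → parity (k * 2) ≡ 0ℙ
parity-*2 k = trans (ℙ.*-homo-* k 2) (ℙ.*-zeroʳ (parity k))

sign-IsEven : {σ : Sym n} → IsEven σ → sign σ ≡ 0ℙ
sign-IsEven {σ = σ} (ps , proper , (k , length≡) , σ≈ps) = begin
  sign σ                ≡⟨ sign-cong {σ = σ} {prodTransp ps} σ≈ps ⟩
  sign (prodTransp ps)  ≡⟨ sign-prodTransp ps proper ⟩
  parity (length ps)    ≡⟨ cong parity length≡ ⟩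
  parity (k * 2)        ≡⟨ parity-*2 k ⟩
  0ℙ                    ∎
  where open ≡-Reasoning

4∣-from-parity : ∀ m → parity m ≡ 0ℙ → parity ⌊ m /2⌋ ≡ 0ℙ → 4 ∣ m
4∣-from-parity zero _ _ = divides 0 refl
4∣-from-parity (suc zero) () _
4∣-from-parity (suc (suc (suc zero))) () _
4∣-from-parity (suc (suc zero)) _ ()
4∣-from-parity (suc (suc (suc (suc m)))) m-even ⌊m/2⌋-even with 4∣-from-parity m m-even ⌊m/2⌋-even
... | divides q m≡q*4 = divides (suc q) (cong (4 +_) m≡q*4)

theorem1 : (n m : ℕ) → 2 ≤ n → 2 ≤ m → 2 ∣ m
    → (x : Fin m → Fin n) → Injective _≡_ _≡_ x
    → (∀ (σ : Sym n) → ⟨ prodTransp (adjPairs m x) ⟩ σ → IsEven σ)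
    → ¬ IsPerfectCodeOfSym n ⟨ prodTransp (adjPairs m x) ⟩
theorem1 n m _ 2≤m (divides q m≡q*2) x x-inj ⟨t⟩-even =
  ¬perfectCode-⟨square⟩ {g = squareRoot m x} (squareRoot-square 4∣m x x-inj) (prodTransp-adjPairs-involutive m x x-inj)
                        (prodTransp-adjPairs-nontrivial m x x-inj 2≤m)
  where
  t = prodTransp (adjPairs m x)
  ⌊m/2⌋-even : parity ⌊ m /2⌋ ≡ 0ℙ
  ⌊m/2⌋-even = trans (sym (sign-prodTransp-adjPairs m x x-inj)) (sign-IsEven {σ = t} (⟨t⟩-even t (1 , λ _ → refl)))
  4∣m : 4 ∣ m
  4∣m = 4∣-from-parity m (trans (cong parity m≡q*2) (parity-*2 q)) ⌊m/2⌋-even
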